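{- The clause set $S_\triangleright(\eta)$ is refutable by a clause set cycle (over the language $L'_\triangleright$).
   Context: $L'_\triangleright$ is the one-sorted first-order language (its single sort playing the role of $\mathsf{nat}$) with function symbols $0$ (constant), $s$ (unary), $+$ (binary, infix) and a binary predicate symbol $\triangleright$ (infix); $\eta$ is a distinguished variable. $S_\triangleright(\eta)$ is the clause set (conjunction) consisting of: $\forall x\,x+0=x$; $\forall x\forall y\,x+sy=s(x+y)$; $0\triangleright0$; $\forall x\forall y\,(x\triangleright y\to sx\triangleright(sx+y))$; $\forall y\,\neg\,\eta\triangleright y$. For $k\in\mathbb{N}$, $\overline{k}=s^k0$. A clause is a formula $\forall\vec y\,(l_1\vee\dots\vee l_k)$ with literals $l_i$, a clause set a finite conjunction of clauses. $\varphi\models\psi$ means every structure and variable assignment satisfying $\varphi$ satisfies $\psi$. A clause set $S(\eta)$ is a clause set cycle if $S(s\eta)\models S(\eta)$ and $S(0)\models\bot$. A clause set $R(\eta)$ is refuted by (refutable by) a clause set cycle if there is a clause set cycle $S(\eta)$ and $n\in\mathbb{N}$ with $R(s^n\eta)\models S(\eta)$ and $R(\overline{k})\models\bot$ for all $k\in\{0,\dots,n-1\}$. -}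

module Defs where

open import Data.Nat using (ℕ; zero; suc; _<_)
open import Data.Fin using (Fin) renaming (zero to fz; suc to fs)
open import Data.List using (List; []; _∷_)
open import Data.List.Relation.Unary.All using (All)
open import Data.Empty using (⊥)
open import Data.Product using (Σ; _×_)
open import Relation.Nullary using (¬_)
open import Relation.Binary.PropositionalEquality using (_≡_)

-- Term n : terms built from n bound variables (of the clause prefix ∀ȳ),
-- the distinguished free variable η, and the symbols 0, s, +.
data Term (n : ℕ) : Set where
  var  : Fin n → Term n
  eta  : Term n
  zer  : Term n
  suc' : Term n → Term n
  _⊕_  : Term n → Term n → Term n

data Atom (n : ℕ) : Set where
  _≐_ : Term n → Term n → Atom n
  _▷_ : Term n → Term n → Atom n

data Literal (n : ℕ) : Set where
  pos : Atom n → Literal n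
  neg : Atom n → Literal n

-- a clause ∀y₁…yₙ (l₁ ∨ … ∨ lₖ)
record Clause : Set where
  constructor ∀[_]_
  field
    arity : ℕ
    lits  : List (Literal arity)

ClauseSet : Set
ClauseSet = List Clause

weaken : ∀ {n} → Term 0 → Term n
weaken (var ())
weaken eta = eta
weaken zer = zer
weaken (suc' t) = suc' (weaken t)
weaken (t ⊕ u) = weaken t ⊕ weaken u

substT : ∀ {n} → Term 0 → Term n → Term n
substT r (var i) = var i
substT r eta = weaken r
substT r zer = zer
substT r (suc' t) = suc' (substT r t)
substT r (t ⊕ u) = substT r t ⊕ substT r u

substA : ∀ {n} → Term 0 → Atom n → Atom n
substA r (t ≐ u) = substT r t ≐ substT r u
substA r (t ▷ u) = substT r t ▷ substT r u

substL : ∀ {n} → Term 0 → Literal n → Literal n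
substL r (pos a) = pos (substA r a)
substL r (neg a) = neg (substA r a)

mapL : ∀ {A B : Set} → (A → B) → List A → List B
mapL f [] = []
mapL f (x ∷ xs) = f x ∷ mapL f xs

substC : Term 0 → Clause → Clause
substC r (∀[ n ] ls) = ∀[ n ] mapL (substL r) ls

_[_] : ClauseSet → Term 0 → ClauseSet
S [ r ] = mapL (substC r) S

num : ℕ → Term 0
num zero = zer
num (suc k) = suc' (num k)

sⁿη : ℕ → Term 0
sⁿη zero = eta
sⁿη (suc k) = suc' (sⁿη k)

-- Semantics: L'▷-structures (equality interpreted as identity)
record Structure : Set₁ where
  field
    Carrier : Set
    z   : Carrier
    sc  : Carrier → Carrier
    pl  : Carrier → Carrier → Carrier
    tri : Carrier → Carrier → Set

module _ (M : Structure) where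
  open Structure M

  evalT : ∀ {n} → (Fin n → Carrier) → Carrier → Term n → Carrier
  evalT ρ e (var i) = ρ i
  evalT ρ e eta = e
  evalT ρ e zer = z
  evalT ρ e (suc' t) = sc (evalT ρ e t)
  evalT ρ e (t ⊕ u) = pl (evalT ρ e t) (evalT ρ e u)

  satA : ∀ {n} → (Fin n → Carrier) → Carrier → Atom n → Set
  satA ρ e (t ≐ u) = evalT ρ e t ≡ evalT ρ e u
  satA ρ e (t ▷ u) = tri (evalT ρ e t) (evalT ρ e u)

  satL : ∀ {n} → (Fin n → Carrier) → Carrier → Literal n → Set
  satL ρ e (pos a) = satA ρ e a
  satL ρ e (neg a) = ¬ satA ρ e a

  -- classical reading of a disjunction: not all literals are false
  satC : Carrier → Clause → Set
  satC e (∀[ n ] ls) = (ρ : Fin n → Carrier) → ¬ All (λ l → ¬ satL ρ e l) ls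

  -- e is the value assigned to η
  satS : Carrier → ClauseSet → Set
  satS e S = All (satC e) S

_⊨_ : ClauseSet → ClauseSet → Set₁
φ ⊨ ψ = (M : Structure) (e : Structure.Carrier M) → satS M e φ → satS M e ψ

_⊨⊥ : ClauseSet → Set₁
φ ⊨⊥ = (M : Structure) (e : Structure.Carrier M) → ¬ satS M e φ

IsClauseSetCycle : ClauseSet → Set₁
IsClauseSetCycle S = ((S [ suc' eta ]) ⊨ S) × ((S [ zer ]) ⊨⊥)

RefutableByCycle : ClauseSet → Set₁
RefutableByCycle R =
  Σ ClauseSet λ S → IsClauseSetCycle S ×
    Σ ℕ λ n → ((R [ sⁿη n ]) ⊨ S) × ((k : ℕ) → k < n → (R [ num k ]) ⊨⊥)

private
  x y : Term 2
  x = var fz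
  y = var (fs fz)
  x₁ : Term 1
  x₁ = var fz

S▷ : ClauseSet
S▷ =
  (∀[ 1 ] (pos ((x₁ ⊕ zer) ≐ x₁) ∷ [])) ∷
  (∀[ 2 ] (pos ((x ⊕ suc' y) ≐ suc' (x ⊕ y)) ∷ [])) ∷
  (∀[ 0 ] (pos (zer ▷ zer) ∷ [])) ∷
  (∀[ 2 ] (neg (x ▷ y) ∷ pos (suc' x ▷ (suc' x ⊕ y)) ∷ [])) ∷
  (∀[ 1 ] (neg (eta ▷ x₁) ∷ [])) ∷
  []

-- S▷(η) is itself a clause set cycle, so it refutes itself with n = 0.
-- In S▷(sη), any η ▷ y would give sη ▷ (sη + y) by the ▷-step clause, which
-- the last clause of S▷(sη) forbids; so S▷(sη) ⊨ ∀y ¬ η ▷ y, and the other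
-- clauses do not mention η.  In S▷(0) the axiom 0 ▷ 0 contradicts ∀y ¬ 0 ▷ y.
module Submission where

open import Defs
open import Data.Fin using () renaming (zero to fz; suc to fs)
open import Data.List using ([]; _∷_)
open import Data.List.Relation.Unary.All using ([]; _∷_)
open import Data.Product using (_,_)
open import Relation.Nullary using (¬_)
open import Relation.Binary.PropositionalEquality using (_≡_; refl; cong; cong₂; subst)

substT-eta : ∀ {n} (t : Term n) → substT eta t ≡ t
substT-eta (var i)  = refl
substT-eta eta      = refl
substT-eta zer      = refl
substT-eta (suc' t) = cong suc' (substT-eta t)
substT-eta (t ⊕ u)  = cong₂ _⊕_ (substT-eta t) (substT-eta u)

substL-eta : ∀ {n} (l : Literal n) → substL eta l ≡ l
substL-eta (pos (t ≐ u)) = cong₂ (λ a b → pos (a ≐ b)) (substT-eta t) (substT-eta u)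
substL-eta (pos (t ▷ u)) = cong₂ (λ a b → pos (a ▷ b)) (substT-eta t) (substT-eta u)
substL-eta (neg (t ≐ u)) = cong₂ (λ a b → neg (a ≐ b)) (substT-eta t) (substT-eta u)
substL-eta (neg (t ▷ u)) = cong₂ (λ a b → neg (a ▷ b)) (substT-eta t) (substT-eta u)

mapL-id : ∀ {A : Set} (f : A → A) → (∀ a → f a ≡ a) → ∀ xs → mapL f xs ≡ xs
mapL-id f f≗id []       = refl
mapL-id f f≗id (x ∷ xs) = cong₂ _∷_ (f≗id x) (mapL-id f f≗id xs)

substC-eta : ∀ C → substC eta C ≡ C
substC-eta (∀[ n ] ls) = cong (∀[ n ]_) (mapL-id (substL eta) substL-eta ls)

[eta]-identity : ∀ S → S [ eta ] ≡ S
[eta]-identity = mapL-id (substC eta) substC-eta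

cycle⇒refutableByCycle : ∀ {S} → IsClauseSetCycle S → RefutableByCycle S
cycle⇒refutableByCycle {S} cycle =
  S , cycle , 0 , (λ M e sat → subst (satS M e) ([eta]-identity S) sat) , (λ k ())

S▷-step : (S▷ [ suc' eta ]) ⊨ S▷
S▷-step M e (plus-zero ∷ plus-suc ∷ ▷-base ∷ ▷-step ∷ sη-clause ∷ []) =
  plus-zero ∷ plus-suc ∷ ▷-base ∷ ▷-step ∷ η-clause ∷ []
  where
  open Structure M

  sη-has-no-▷ : ∀ y → ¬ tri (sc e) y
  sη-has-no-▷ y t = sη-clause (λ _ → y) ((λ ¬t → ¬t t) ∷ [])

  ▷-succ : ∀ x y → tri x y → ¬ ¬ tri (sc x) (pl (sc x) y)
  ▷-succ x y t ¬t′ = ▷-step (λ { fz → x ; (fs fz) → y }) ((λ ¬t → ¬t t) ∷ ¬t′ ∷ [])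

  η-clause : satC M e (∀[ 1 ] (neg (eta ▷ var fz) ∷ []))
  η-clause ρ (¬¬t ∷ []) = ¬¬t (λ t → ▷-succ e (ρ fz) t (sη-has-no-▷ _))

S▷-base : (S▷ [ zer ]) ⊨⊥
S▷-base M e (_ ∷ _ ∷ ▷-base ∷ _ ∷ 0-clause ∷ []) = 0▷0 (0-has-no-▷ z)
  where
  open Structure M

  0▷0 : ¬ ¬ tri z z
  0▷0 ¬t = ▷-base (λ ()) (¬t ∷ [])

  0-has-no-▷ : ∀ y → ¬ tri z y
  0-has-no-▷ y t = 0-clause (λ _ → y) ((λ ¬t → ¬t t) ∷ [])

lemma4p2 : RefutableByCycle S▷
lemma4p2 = cycle⇒refutableByCycle (S▷-step , S▷-base)
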